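{- If $p>2$ is a prime, then there exist $\binom{p}{2}$ Hamiltonian paths on a $p$-element vertex set such that the union of any two distinct ones among them contains a Hamiltonian cycle on that vertex set.
   Context: A Hamiltonian path on a vertex set $V$ is a spanning path of the complete graph on $V$, regarded as an unordered edge set. The union of two graphs on $V$ is the graph on $V$ with the union of their edge sets. A Hamiltonian cycle on $V$ is a cycle through all vertices of $V$. -}

module Defs where

open import Level using (0ℓ)
open import Data.Nat using (ℕ; suc; _∸_)
open import Data.Fin using (Fin; toℕ)
open import Data.Fin.Permutation using (Permutation′; _⟨$⟩ʳ_)
open import Data.Product using (_×_; ∃₂)
open import Data.Sum using (_⊎_)
open import Function.Bundles using (_⇔_)
open import Relation.Binary.PropositionalEquality using (_≡_)

-- A graph on the vertex set Fin n, given by its edge set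
-- (an edge relation; only the unordered pairs it relates matter).
Graph : ℕ → Set₁
Graph n = Fin n → Fin n → Set

Consec : ∀ {n} → Fin n → Fin n → Set
Consec i j = toℕ j ≡ suc (toℕ i)

CycConsec : ∀ {n} → Fin n → Fin n → Set
CycConsec {n} i j = Consec i j ⊎ (toℕ i ≡ n ∸ 1 × toℕ j ≡ 0)

-- Edge set of the spanning path visiting σ(0), σ(1), ..., σ(n-1):
-- u,v adjacent iff they occur at consecutive positions (either orientation).
PathEdge : ∀ {n} → Permutation′ n → Graph n
PathEdge σ u v = ∃₂ λ i j → Consec i j ×
  ((σ ⟨$⟩ʳ i ≡ u × σ ⟨$⟩ʳ j ≡ v) ⊎ (σ ⟨$⟩ʳ i ≡ v × σ ⟨$⟩ʳ j ≡ u))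

CycleEdge : ∀ {n} → Permutation′ n → Graph n
CycleEdge σ u v = ∃₂ λ i j → CycConsec i j ×
  ((σ ⟨$⟩ʳ i ≡ u × σ ⟨$⟩ʳ j ≡ v) ⊎ (σ ⟨$⟩ʳ i ≡ v × σ ⟨$⟩ʳ j ≡ u))

SameEdges : ∀ {n} → Graph n → Graph n → Set
SameEdges G H = ∀ u v → G u v ⇔ H u v

IsHamPath : ∀ {n} → Graph n → Set
IsHamPath {n} G = Σ (Permutation′ n) λ σ → SameEdges G (PathEdge σ)
  where open import Data.Product using (Σ)

_∪_ : ∀ {n} → Graph n → Graph n → Graph n
(G ∪ H) u v = G u v ⊎ H u v

HasHamCycle : ∀ {n} → Graph n → Set
HasHamCycle {n} G = Σ (Permutation′ n) λ τ → ∀ u v → CycleEdge τ u v → G u v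
  where open import Data.Product using (Σ)

-- Identify the vertex set with ℤ/p. For a start s and a step a ∈ {1, …, (p-1)/2} the
-- progression s, s+a, …, s+(p-1)a is a Hamiltonian path because p is prime, and there are
-- p(p-1)/2 such paths. Its edges are the pairs {x, x+a} other than the closing pair {s-a, s}.
-- Hence two paths with the same step differ exactly in their closing pairs, and their union
-- contains the whole cycle of step a; paths with steps a ≠ b differ because a ≢ ±b. For a ≠ b
-- the path of step a is closed by a Pósa rotation: if the path of step b contains the chords
-- {s, s+β} and {s-a, s-a+β} for some β ≢ 0, reversing the part of the first path from s+β to
-- its end s-a yields a Hamiltonian cycle, and β = b or β = -b always works.
module Submission where

open import Defs
open import Data.Nat using (ℕ; zero; suc; _+_; _*_; _∸_; _≤_; _<_; _>_; z≤n; s≤s; s≤s⁻¹; z<s; _≤?_; NonZero)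
open import Data.Nat.Properties
open import Data.Nat.DivMod
  using (_%_; _/_; _mod_; m%n<n; m≡m%n+[m/n]*n; m*n/n≡m; %-distribˡ-+; m%n%n≡m%n; [m+kn]%n≡m%n; m<n⇒m%n≡m)
open import Data.Nat.Divisibility using (_∣_; m%n≡0⇒n∣m; >⇒∤)
open import Data.Nat.Primality using (Prime; euclidsLemma; prime⇒irreducible)
open import Data.Nat.Combinatorics using (_C_; _P_; nCk≡nPk/k!)
open import Data.Nat.Tactic.RingSolver using (solve-∀)
open import Data.Fin using (Fin; toℕ; fromℕ; fromℕ<; inject₁; punchOut; remQuot; combine)
  renaming (zero to fz; suc to fs)
open import Data.Fin.Properties
  using (any?; pigeonhole; combine-remQuot; punchOut-injective; toℕ-injective; toℕ-fromℕ; toℕ-fromℕ<;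
         toℕ-inject₁; toℕ<n)
  renaming (_≟_ to _≟ᶠ_)
open import Data.Fin.Permutation using (Permutation′; _⟨$⟩ʳ_; _⟨$⟩ˡ_; permutation; inverseˡ; inverseʳ; _∘ₚ_)
open import Data.Product using (Σ; ∃; _×_; _,_; proj₁; proj₂; uncurry)
open import Data.Sum using (_⊎_; inj₁; inj₂; [_,_]′)
open import Data.Empty using (⊥-elim)
open import Function.Base using (id; _∘_; case_of_)
open import Function.Bundles using (Equivalence; mk⇔)
open import Function.Definitions using (Injective)
open import Relation.Binary.Core using (_⇒_)
open import Relation.Binary.Definitions using (Symmetric)
open import Relation.Nullary using (¬_; Dec; yes; no; contradiction)
open import Relation.Binary.PropositionalEquality
  using (_≡_; _≢_; refl; sym; trans; cong; subst; subst₂; module ≡-Reasoning)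

[m%n+k]%n≡[m+k]%n : ∀ m k n .{{_ : NonZero n}} → (m % n + k) % n ≡ (m + k) % n
[m%n+k]%n≡[m+k]%n m k n = begin
  (m % n + k) % n          ≡⟨ %-distribˡ-+ (m % n) k n ⟩
  (m % n % n + k % n) % n  ≡⟨ cong (λ r → (r + k % n) % n) (m%n%n≡m%n m n) ⟩
  (m % n + k % n) % n      ≡⟨ %-distribˡ-+ m k n ⟨
  (m + k) % n              ∎
  where open ≡-Reasoning

-- Adding n * m, i.e. -m modulo suc n, to both sides.
%-cancelˡ-+ : ∀ m {a b} n → (m + a) % suc n ≡ (m + b) % suc n → a % suc n ≡ b % suc n
%-cancelˡ-+ m {a} {b} n eq = begin
  a % suc n                          ≡⟨ [m+kn]%n≡m%n a m (suc n) ⟨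
  (a + m * suc n) % suc n            ≡⟨ cong (_% suc n) (absorb m n a) ⟩
  (m + a + n * m) % suc n            ≡⟨ [m%n+k]%n≡[m+k]%n (m + a) (n * m) (suc n) ⟨
  ((m + a) % suc n + n * m) % suc n  ≡⟨ cong (λ r → (r + n * m) % suc n) eq ⟩
  ((m + b) % suc n + n * m) % suc n  ≡⟨ [m%n+k]%n≡[m+k]%n (m + b) (n * m) (suc n) ⟩
  (m + b + n * m) % suc n            ≡⟨ cong (_% suc n) (absorb m n b) ⟨
  (b + m * suc n) % suc n            ≡⟨ [m+kn]%n≡m%n b m (suc n) ⟩
  b % suc n                          ∎
  where
  open ≡-Reasoning
  absorb : ∀ m n x → x + m * suc n ≡ m + x + n * m
  absorb = solve-∀

m<n∧n∣m⇒m≡0 : ∀ {m n} → m < n → n ∣ m → m ≡ 0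
m<n∧n∣m⇒m≡0 {zero}  _   _   = refl
m<n∧n∣m⇒m≡0 {suc m} m<n n∣m = contradiction n∣m (>⇒∤ m<n)

module Shift (n : ℕ) where

  infixl 6 _⊕_
  _⊕_ : Fin (suc n) → ℕ → Fin (suc n)
  x ⊕ a = (toℕ x + a) mod suc n

  toℕ-⊕ : ∀ x a → toℕ (x ⊕ a) ≡ (toℕ x + a) % suc n
  toℕ-⊕ x a = toℕ-fromℕ< _

  ⊕-period : ∀ x k → x ⊕ k * suc n ≡ x
  ⊕-period x k = toℕ-injective (begin
    toℕ (x ⊕ k * suc n)          ≡⟨ toℕ-⊕ x (k * suc n) ⟩
    (toℕ x + k * suc n) % suc n  ≡⟨ [m+kn]%n≡m%n (toℕ x) k (suc n) ⟩
    toℕ x % suc n                ≡⟨ m<n⇒m%n≡m (toℕ<n x) ⟩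
    toℕ x                        ∎)
    where open ≡-Reasoning

  ⊕-identityʳ : ∀ x → x ⊕ 0 ≡ x
  ⊕-identityʳ x = ⊕-period x 0

  ⊕-assoc : ∀ x a b → x ⊕ a ⊕ b ≡ x ⊕ (a + b)
  ⊕-assoc x a b = toℕ-injective (begin
    toℕ (x ⊕ a ⊕ b)                    ≡⟨ toℕ-⊕ (x ⊕ a) b ⟩
    (toℕ (x ⊕ a) + b) % suc n          ≡⟨ cong (λ r → (r + b) % suc n) (toℕ-⊕ x a) ⟩
    ((toℕ x + a) % suc n + b) % suc n  ≡⟨ [m%n+k]%n≡[m+k]%n (toℕ x + a) b (suc n) ⟩
    (toℕ x + a + b) % suc n            ≡⟨ cong (_% suc n) (+-assoc (toℕ x) a b) ⟩
    (toℕ x + (a + b)) % suc n          ≡⟨ toℕ-⊕ x (a + b) ⟨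
    toℕ (x ⊕ (a + b))                  ∎)
    where open ≡-Reasoning

  ⊕-comm : ∀ x a b → x ⊕ a ⊕ b ≡ x ⊕ b ⊕ a
  ⊕-comm x a b = begin
    x ⊕ a ⊕ b    ≡⟨ ⊕-assoc x a b ⟩
    x ⊕ (a + b)  ≡⟨ cong (x ⊕_) (+-comm a b) ⟩
    x ⊕ (b + a)  ≡⟨ ⊕-assoc x b a ⟨
    x ⊕ b ⊕ a    ∎
    where open ≡-Reasoning

  -- n * a plays the role of -a modulo suc n.
  ⊕-inverseʳ : ∀ x a → x ⊕ a ⊕ n * a ≡ x
  ⊕-inverseʳ x a = begin
    x ⊕ a ⊕ n * a  ≡⟨ ⊕-assoc x a (n * a) ⟩
    x ⊕ suc n * a  ≡⟨ cong (x ⊕_) (*-comm (suc n) a) ⟩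
    x ⊕ a * suc n  ≡⟨ ⊕-period x a ⟩
    x              ∎
    where open ≡-Reasoning

  ⊕-inverseˡ : ∀ x a → x ⊕ n * a ⊕ a ≡ x
  ⊕-inverseˡ x a = trans (⊕-comm x (n * a) a) (⊕-inverseʳ x a)

  ⊕-cancelʳ : ∀ {x y} a → x ⊕ a ≡ y ⊕ a → x ≡ y
  ⊕-cancelʳ {x} {y} a eq = begin
    x              ≡⟨ ⊕-inverseʳ x a ⟨
    x ⊕ a ⊕ n * a  ≡⟨ cong (_⊕ n * a) eq ⟩
    y ⊕ a ⊕ n * a  ≡⟨ ⊕-inverseʳ y a ⟩
    y              ∎
    where open ≡-Reasoning

  ⊕-cancelˡ : ∀ x {a b} → x ⊕ a ≡ x ⊕ b → a % suc n ≡ b % suc n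
  ⊕-cancelˡ x {a} {b} eq =
    %-cancelˡ-+ (toℕ x) n (trans (sym (toℕ-⊕ x a)) (trans (cong toℕ eq) (toℕ-⊕ x b)))

  ⊕-cancelˡ-< : ∀ x {a b} → a < suc n → b < suc n → x ⊕ a ≡ x ⊕ b → a ≡ b
  ⊕-cancelˡ-< x {a} {b} a<p b<p eq =
    trans (sym (m<n⇒m%n≡m a<p)) (trans (⊕-cancelˡ x eq) (m<n⇒m%n≡m b<p))

  x⊕a≢x : ∀ x {a} → 0 < a → a < suc n → x ⊕ a ≢ x
  x⊕a≢x x 0<a a<p eq = <⇒≢ 0<a (sym (⊕-cancelˡ-< x a<p z<s (trans eq (sym (⊕-identityʳ x)))))

  private
    ⊕-*-injective-≤ : Prime (suc n) → ∀ x {a i j} → 0 < a → a < suc n → i ≤ j → j < suc n →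
                      x ⊕ j * a ≡ x ⊕ i * a → j ≡ i
    ⊕-*-injective-≤ p-prime x {a} {i} {j} 0<a a<p i≤j j<p eq = ≤-antisym (m∸n≡0⇒m≤n d≡0) i≤j
      where
      d : ℕ
      d = j ∸ i
      shifted : x ⊕ i * a ⊕ d * a ≡ x ⊕ i * a ⊕ 0
      shifted = begin
        x ⊕ i * a ⊕ d * a    ≡⟨ ⊕-assoc x (i * a) (d * a) ⟩
        x ⊕ (i * a + d * a)  ≡⟨ cong (x ⊕_) (*-distribʳ-+ a i d) ⟨
        x ⊕ (i + d) * a      ≡⟨ cong (λ k → x ⊕ k * a) (m+[n∸m]≡n i≤j) ⟩
        x ⊕ j * a            ≡⟨ eq ⟩
        x ⊕ i * a            ≡⟨ ⊕-identityʳ (x ⊕ i * a) ⟨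
        x ⊕ i * a ⊕ 0        ∎
        where open ≡-Reasoning
      d≡0 : d ≡ 0
      d≡0 with euclidsLemma d a p-prime (m%n≡0⇒n∣m (d * a) (suc n) (⊕-cancelˡ (x ⊕ i * a) shifted))
      ... | inj₁ p∣d = m<n∧n∣m⇒m≡0 (≤-<-trans (m∸n≤m j i) j<p) p∣d
      ... | inj₂ p∣a = contradiction (m<n∧n∣m⇒m≡0 a<p p∣a) (>⇒≢ 0<a)

  ⊕-*-injective : Prime (suc n) → ∀ x {a i j} → 0 < a → a < suc n → i < suc n → j < suc n →
                  x ⊕ i * a ≡ x ⊕ j * a → i ≡ j
  ⊕-*-injective p-prime x {i = i} {j} 0<a a<p i<p j<p eq with ≤-total i j
  ... | inj₁ i≤j = sym (⊕-*-injective-≤ p-prime x 0<a a<p i≤j j<p (sym eq))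
  ... | inj₂ j≤i = ⊕-*-injective-≤ p-prime x 0<a a<p j≤i i<p eq

injective⇒surjective : ∀ {n} (f : Fin n → Fin n) → Injective _≡_ _≡_ f →
                       ∀ y → Σ (Fin n) λ x → f x ≡ y
injective⇒surjective f f-inj y with any? (λ x → f x ≟ᶠ y)
... | yes found = found
injective⇒surjective {suc n} f f-inj y | no missed
  with i , j , i<j , eq ← pigeonhole (n<1+n n) (λ x → punchOut {i = y} (λ y≡fx → missed (x , sym y≡fx)))
  = contradiction (cong toℕ (f-inj (punchOut-injective {i = y} _ _ eq))) (<⇒≢ i<j)

injective⇒permutation : ∀ {n} (f : Fin n → Fin n) → Injective _≡_ _≡_ f → Permutation′ n
injective⇒permutation f f-inj =
  permutation f (λ y → proj₁ (surj y)) (λ y → proj₂ (surj y)) (λ x → f-inj (proj₂ (surj (f x))))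
  where
  surj : ∀ y → Σ _ λ x → f x ≡ y
  surj = injective⇒surjective f f-inj

⟨$⟩ʳ-injective : ∀ {n} (π : Permutation′ n) → Injective _≡_ _≡_ (π ⟨$⟩ʳ_)
⟨$⟩ʳ-injective π eq = trans (sym (inverseˡ π)) (trans (cong (π ⟨$⟩ˡ_) eq) (inverseˡ π))

remQuot-injective : ∀ {m} n → Injective _≡_ _≡_ (remQuot {m} n)
remQuot-injective {m} n {k} {l} eq =
  trans (sym (combine-remQuot {m} n k)) (trans (cong (uncurry combine) eq) (combine-remQuot {m} n l))

inject₁→suc : ∀ {n} (k : Fin n) → Consec (inject₁ k) (fs k)
inject₁→suc k = cong suc (sym (toℕ-inject₁ k))

module _ {n : ℕ} where

  PathEdge-sym : (σ : Permutation′ n) → Symmetric (PathEdge σ)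
  PathEdge-sym σ (i , j , c , inj₁ (σi≡u , σj≡v)) = i , j , c , inj₂ (σi≡u , σj≡v)
  PathEdge-sym σ (i , j , c , inj₂ (σi≡v , σj≡u)) = i , j , c , inj₁ (σi≡v , σj≡u)

  PathEdge-∪-sym : (σ τ : Permutation′ n) → Symmetric (PathEdge σ ∪ PathEdge τ)
  PathEdge-∪-sym σ τ (inj₁ e) = inj₁ (PathEdge-sym σ e)
  PathEdge-∪-sym σ τ (inj₂ e) = inj₂ (PathEdge-sym τ e)

  consec⇒PathEdge : (σ : Permutation′ n) {i j : Fin n} → Consec i j → PathEdge σ (σ ⟨$⟩ʳ i) (σ ⟨$⟩ʳ j)
  consec⇒PathEdge σ {i} {j} c = i , j , c , inj₁ (refl , refl)

  HasHamCycle-intro : {G : Graph n} (τ : Permutation′ n) → Symmetric G →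
                      (∀ {i j} → CycConsec i j → G (τ ⟨$⟩ʳ i) (τ ⟨$⟩ʳ j)) → HasHamCycle G
  HasHamCycle-intro τ G-sym edge =
    τ , λ { _ _ (i , j , c , inj₁ (refl , refl)) → edge c
          ; _ _ (i , j , c , inj₂ (refl , refl)) → G-sym (edge c) }

¬PathEdge-last-first : ∀ {n} (σ : Permutation′ (suc n)) → 1 < n → ¬ PathEdge σ (σ ⟨$⟩ʳ fromℕ n) (σ ⟨$⟩ʳ fz)
¬PathEdge-last-first σ 1<n (i , j , i→j , inj₁ (_ , σj≡σ0))
  with refl ← ⟨$⟩ʳ-injective σ σj≡σ0 = case i→j of λ ()
¬PathEdge-last-first {n} σ 1<n (i , j , i→j , inj₂ (σi≡σ0 , σj≡σlast))
  with refl ← ⟨$⟩ʳ-injective σ σi≡σ0 | refl ← ⟨$⟩ʳ-injective σ σj≡σlast =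
  <⇒≢ 1<n (trans (sym i→j) (toℕ-fromℕ n))

-- The involution of the positions 0, …, n that fixes 0, …, i and reverses i+1, …, n.
module Reflection {n : ℕ} (i : ℕ) where

  private
    N : ℕ
    N = n + suc i

    reflect-≤n : ∀ {k} → i < k → N ∸ k ≤ n
    reflect-≤n {k} i<k = begin
      N ∸ k      ≤⟨ ∸-monoʳ-≤ N i<k ⟩
      N ∸ suc i  ≡⟨ m+n∸n≡m n (suc i) ⟩
      n          ∎
      where open ≤-Reasoning

  reflect : Fin (suc n) → Fin (suc n)
  reflect k with toℕ k ≤? i
  ... | yes _  = k
  ... | no k≰i = fromℕ< (s≤s (reflect-≤n (≰⇒> k≰i)))

  toℕ-reflect-≤ : ∀ k → toℕ k ≤ i → toℕ (reflect k) ≡ toℕ k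
  toℕ-reflect-≤ k k≤i with toℕ k ≤? i
  ... | yes _  = refl
  ... | no k≰i = contradiction k≤i k≰i

  toℕ-reflect-> : ∀ k → i < toℕ k → toℕ (reflect k) ≡ N ∸ toℕ k
  toℕ-reflect-> k i<k with toℕ k ≤? i
  ... | yes k≤i = contradiction k≤i (<⇒≱ i<k)
  ... | no _    = toℕ-fromℕ< _

  reflect-≤ : ∀ k → toℕ k ≤ i → reflect k ≡ k
  reflect-≤ k k≤i = toℕ-injective (toℕ-reflect-≤ k k≤i)

  reflect-involutive : ∀ k → reflect (reflect k) ≡ k
  reflect-involutive k with toℕ k ≤? i
  ... | yes k≤i = reflect-≤ k k≤i
  ... | no k≰i = toℕ-injective (begin-equality
    toℕ (reflect k′)  ≡⟨ toℕ-reflect-> k′ i<k′ ⟩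
    N ∸ toℕ k′        ≡⟨ cong (N ∸_) (toℕ-fromℕ< k′<p) ⟩
    N ∸ (N ∸ toℕ k)   ≡⟨ m∸[m∸n]≡n (≤-trans (s≤s⁻¹ (toℕ<n k)) (m≤m+n n (suc i))) ⟩
    toℕ k             ∎)
    where
    open ≤-Reasoning
    k′<p : N ∸ toℕ k < suc n
    k′<p = s≤s (reflect-≤n (≰⇒> k≰i))
    k′ : Fin (suc n)
    k′ = fromℕ< k′<p
    i<k′ : i < toℕ k′
    i<k′ = begin-strict
      i          <⟨ n<1+n i ⟩
      suc i      ≡⟨ m+n∸m≡n n (suc i) ⟨
      N ∸ n      ≤⟨ ∸-monoʳ-≤ N (s≤s⁻¹ (toℕ<n k)) ⟩
      N ∸ toℕ k  ≡⟨ toℕ-fromℕ< k′<p ⟨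
      toℕ k′     ∎

  reflection : Permutation′ (suc n)
  reflection = permutation reflect reflect reflect-involutive reflect-involutive

  reflect-reverses : ∀ {k l} → Consec k l → i < toℕ k → Consec (reflect l) (reflect k)
  reflect-reverses {k} {l} k→l i<k = begin
    toℕ (reflect k)        ≡⟨ toℕ-reflect-> k i<k ⟩
    suc N ∸ suc (toℕ k)    ≡⟨ cong (suc N ∸_) k→l ⟨
    suc N ∸ toℕ l          ≡⟨ +-∸-assoc 1 (≤-trans (s≤s⁻¹ (toℕ<n l)) (m≤m+n n (suc i))) ⟩
    suc (N ∸ toℕ l)        ≡⟨ cong suc (toℕ-reflect-> l (<-trans i<k (≤-reflexive (sym k→l)))) ⟨
    suc (toℕ (reflect l))  ∎
    where open ≡-Reasoning

  reflect-[1+i] : ∀ k → toℕ k ≡ suc i → reflect k ≡ fromℕ n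
  reflect-[1+i] k k≡1+i = toℕ-injective (begin
    toℕ (reflect k)  ≡⟨ toℕ-reflect-> k (≤-reflexive (sym k≡1+i)) ⟩
    N ∸ toℕ k        ≡⟨ cong (N ∸_) k≡1+i ⟩
    N ∸ suc i        ≡⟨ m+n∸n≡m n (suc i) ⟩
    n                ≡⟨ toℕ-fromℕ n ⟨
    toℕ (fromℕ n)    ∎)
    where open ≡-Reasoning

  toℕ-reflect-last : ∀ k → toℕ k ≡ n → i < n → toℕ (reflect k) ≡ suc i
  toℕ-reflect-last k k≡n i<n = begin
    toℕ (reflect k)  ≡⟨ toℕ-reflect-> k (subst (i <_) (sym k≡n) i<n) ⟩
    N ∸ toℕ k        ≡⟨ cong (N ∸_) k≡n ⟩
    N ∸ n            ≡⟨ m+n∸m≡n n (suc i) ⟩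
    suc i            ∎
    where open ≡-Reasoning

-- Pósa rotation: σ 0, …, σ j, σ n, σ (n-1), …, σ j′ is a Hamiltonian cycle of G.
rotation-cycle : ∀ {n} (σ : Permutation′ (suc n)) {G : Graph (suc n)} → Symmetric G → PathEdge σ ⇒ G →
                 ∀ {j j′} → Consec j j′ →
                 G (σ ⟨$⟩ʳ fz) (σ ⟨$⟩ʳ j′) → G (σ ⟨$⟩ʳ j) (σ ⟨$⟩ʳ fromℕ n) → HasHamCycle G
rotation-cycle {n} σ {G} G-sym path⊆G {j} {j′} j→j′ first-chord last-chord =
  HasHamCycle-intro (reflection ∘ₚ σ) G-sym edge
  where
  open Reflection {n} (toℕ j)

  G-at : ∀ {k l k′ l′} → k ≡ k′ → l ≡ l′ → G (σ ⟨$⟩ʳ k′) (σ ⟨$⟩ʳ l′) → G (σ ⟨$⟩ʳ k) (σ ⟨$⟩ʳ l)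
  G-at refl refl g = g

  consecutive-edge : ∀ {k l} → Consec k l → Dec (toℕ l ≤ toℕ j) → Dec (toℕ k ≤ toℕ j) →
                     G (σ ⟨$⟩ʳ reflect k) (σ ⟨$⟩ʳ reflect l)
  consecutive-edge {k} {l} k→l (yes l≤j) _ =
    G-at (reflect-≤ k k≤j) (reflect-≤ l l≤j) (path⊆G (consec⇒PathEdge σ k→l))
    where
    k≤j : toℕ k ≤ toℕ j
    k≤j = ≤-trans (n≤1+n _) (subst (_≤ toℕ j) k→l l≤j)
  consecutive-edge {k} {l} k→l (no l≰j) (yes k≤j) =
    G-at (toℕ-injective (trans (toℕ-reflect-≤ k k≤j) k≡j))
         (reflect-[1+i] l (trans k→l (cong suc k≡j))) last-chord
    where
    k≡j : toℕ k ≡ toℕ j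
    k≡j = ≤-antisym k≤j (s≤s⁻¹ (subst (toℕ j <_) k→l (≰⇒> l≰j)))
  consecutive-edge k→l (no _) (no k≰j) =
    G-sym (path⊆G (consec⇒PathEdge σ (reflect-reverses k→l (≰⇒> k≰j))))

  edge : ∀ {k l} → CycConsec k l → G (σ ⟨$⟩ʳ reflect k) (σ ⟨$⟩ʳ reflect l)
  edge {k} {l} (inj₁ k→l) = consecutive-edge k→l (toℕ l ≤? toℕ j) (toℕ k ≤? toℕ j)
  edge {k} {l} (inj₂ (k≡n , l≡0)) =
    G-sym (G-at (toℕ-injective l↦0) (toℕ-injective (trans k↦1+j (sym j→j′))) first-chord)
    where
    l↦0 : toℕ (reflect l) ≡ 0
    l↦0 = trans (toℕ-reflect-≤ l (subst (_≤ toℕ j) (sym l≡0) z≤n)) l≡0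
    k↦1+j : toℕ (reflect k) ≡ suc (toℕ j)
    k↦1+j = toℕ-reflect-last k k≡n (subst (_≤ n) j→j′ (s≤s⁻¹ (toℕ<n j′)))

PairwiseHamiltonian : ∀ {I : Set} {n} → (I → Permutation′ n) → Set
PairwiseHamiltonian {I} σ = ∀ {k l : I} → k ≢ l →
  ¬ SameEdges (PathEdge (σ k)) (PathEdge (σ l)) × HasHamCycle (PathEdge (σ k) ∪ PathEdge (σ l))

PairwiseHamiltonian-∘ : ∀ {I J : Set} {n} {σ : I → Permutation′ n} (f : J → I) → Injective _≡_ _≡_ f →
                        PairwiseHamiltonian σ → PairwiseHamiltonian (σ ∘ f)
PairwiseHamiltonian-∘ f f-inj σ-pairwise k≢l = σ-pairwise (λ fk≡fl → k≢l (f-inj fk≡fl))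

module Progressions (n : ℕ) (p-prime : Prime (suc n)) where

  open Shift n

  progression : Fin (suc n) → ∀ {a} → 0 < a → a < suc n → Permutation′ (suc n)
  progression s {a} 0<a a<p = injective⇒permutation (λ j → s ⊕ toℕ j * a)
    (λ eq → toℕ-injective (⊕-*-injective p-prime s 0<a a<p (toℕ<n _) (toℕ<n _) eq))

  last : Fin (suc n)
  last = fromℕ n

  module _ (s : Fin (suc n)) {a} (0<a : 0 < a) (a<p : a < suc n) where

    private
      σ : Permutation′ (suc n)
      σ = progression s 0<a a<p

    progression-first : σ ⟨$⟩ʳ fz ≡ s
    progression-first = ⊕-identityʳ s

    progression-step : ∀ {i j} → Consec i j → σ ⟨$⟩ʳ j ≡ (σ ⟨$⟩ʳ i) ⊕ a
    progression-step {i} {j} i→j = begin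
      s ⊕ toℕ j * a        ≡⟨ cong (λ k → s ⊕ k * a) i→j ⟩
      s ⊕ (a + toℕ i * a)  ≡⟨ cong (s ⊕_) (+-comm a (toℕ i * a)) ⟩
      s ⊕ (toℕ i * a + a)  ≡⟨ ⊕-assoc s (toℕ i * a) a ⟨
      s ⊕ toℕ i * a ⊕ a    ∎
      where open ≡-Reasoning

    progression-wraps : (σ ⟨$⟩ʳ last) ⊕ a ≡ s
    progression-wraps = begin
      s ⊕ toℕ last * a ⊕ a  ≡⟨ cong (λ k → s ⊕ k * a ⊕ a) (toℕ-fromℕ n) ⟩
      s ⊕ n * a ⊕ a         ≡⟨ ⊕-inverseˡ s a ⟩
      s                     ∎
      where open ≡-Reasoning

    progression-edge : ∀ {y} → y ⊕ a ≢ s → PathEdge σ y (y ⊕ a)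
    progression-edge {y} ya≢s = at (σ ⟨$⟩ˡ (y ⊕ a)) (inverseʳ σ)
      where
      at : ∀ k → σ ⟨$⟩ʳ k ≡ y ⊕ a → PathEdge σ y (y ⊕ a)
      at fz     σk≡ya = contradiction (trans (sym σk≡ya) progression-first) ya≢s
      at (fs k) σk≡ya = inject₁ k , fs k , inject₁→suc k ,
        inj₁ (⊕-cancelʳ a (trans (sym (progression-step (inject₁→suc k))) σk≡ya) , σk≡ya)

    PathEdge-progression : ∀ {u v} → PathEdge σ u v → v ≡ u ⊕ a ⊎ u ≡ v ⊕ a
    PathEdge-progression (i , j , i→j , inj₁ (refl , refl)) = inj₁ (progression-step i→j)
    PathEdge-progression (i , j , i→j , inj₂ (refl , refl)) = inj₂ (progression-step i→j)

  module _ {a} (0<a : 0 < a) (a<p : a < suc n) where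

    private
      path : Fin (suc n) → Permutation′ (suc n)
      path s = progression s 0<a a<p

    wrap-edge : ∀ s t → s ≢ t → PathEdge (path t) (path s ⟨$⟩ʳ last) s
    wrap-edge s t s≢t = subst (PathEdge (path t) (path s ⟨$⟩ʳ last)) (progression-wraps s 0<a a<p)
      (progression-edge t 0<a a<p (λ wraps≡t → s≢t (trans (sym (progression-wraps s 0<a a<p)) wraps≡t)))

    start-≢⇒¬SameEdges : ∀ s t → 1 < n → s ≢ t → ¬ SameEdges (PathEdge (path s)) (PathEdge (path t))
    start-≢⇒¬SameEdges s t 1<n s≢t same =
      ¬PathEdge-last-first (path t) 1<n
        (subst (PathEdge (path t) (path t ⟨$⟩ʳ last)) (sym (progression-first t 0<a a<p))
          (Equivalence.to (same (path t ⟨$⟩ʳ last) t) (wrap-edge t s (λ t≡s → s≢t (sym t≡s)))))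

    start-≢⇒HasHamCycle : ∀ s t → s ≢ t → HasHamCycle (PathEdge (path s) ∪ PathEdge (path t))
    start-≢⇒HasHamCycle s t s≢t = HasHamCycle-intro (path s) (PathEdge-∪-sym (path s) (path t)) edge
      where
      edge : ∀ {k l} → CycConsec k l → (PathEdge (path s) ∪ PathEdge (path t)) (path s ⟨$⟩ʳ k) (path s ⟨$⟩ʳ l)
      edge (inj₁ k→l) = inj₁ (consec⇒PathEdge (path s) k→l)
      edge {k} {l} (inj₂ (k≡n , l≡0)) rewrite toℕ-injective {i = k} {last} (trans k≡n (sym (toℕ-fromℕ n)))
                                            | toℕ-injective {i = l} {fz} l≡0 =
        inj₂ (subst (PathEdge (path t) _) (sym (progression-first s 0<a a<p)) (wrap-edge s t s≢t))

  module _ (s t : Fin (suc n)) {a b} (0<a : 0 < a) (a<p : a < suc n) (0<b : 0 < b) (b<p : b < suc n)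
           (a≢b : a ≢ b) (a+b<p : a + b < suc n) where

    private
      σ τ : Permutation′ (suc n)
      σ = progression s 0<a a<p
      τ = progression t 0<b b<p
      e : Fin (suc n)
      e = σ ⟨$⟩ʳ last
      0<a+b : 0 < a + b
      0<a+b = ≤-trans 0<a (m≤m+n a b)

    step-≢⇒¬SameEdges : ¬ SameEdges (PathEdge σ) (PathEdge τ)
    step-≢⇒¬SameEdges same
      with PathEdge-progression t 0<b b<p
             (Equivalence.to (same s (s ⊕ a)) (progression-edge s 0<a a<p (x⊕a≢x s 0<a a<p)))
    ... | inj₁ sa≡sb = a≢b (⊕-cancelˡ-< s a<p b<p sa≡sb)
    ... | inj₂ s≡sab = x⊕a≢x s 0<a+b a+b<p (sym (trans s≡sab (⊕-assoc s a b)))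

    private
      rotate : ∀ β → s ⊕ β ≢ s → PathEdge τ s (s ⊕ β) → PathEdge τ e (e ⊕ β) →
               HasHamCycle (PathEdge σ ∪ PathEdge τ)
      rotate β sβ≢s chordₛ chordₑ = at (σ ⟨$⟩ˡ (s ⊕ β)) (inverseʳ σ)
        where
        at : ∀ k → σ ⟨$⟩ʳ k ≡ s ⊕ β → HasHamCycle (PathEdge σ ∪ PathEdge τ)
        at fz σk≡sβ = contradiction (trans (sym σk≡sβ) (progression-first s 0<a a<p)) sβ≢s
        at (fs k) σk≡sβ = rotation-cycle σ (PathEdge-∪-sym σ τ) inj₁ (inject₁→suc k)
          (inj₂ (subst₂ (PathEdge τ) (sym (progression-first s 0<a a<p)) (sym σk≡sβ) chordₛ))
          (inj₂ (subst (λ x → PathEdge τ x e) (sym σk′≡eβ) (PathEdge-sym τ chordₑ)))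
          where
          σk′≡eβ : σ ⟨$⟩ʳ inject₁ k ≡ e ⊕ β
          σk′≡eβ = ⊕-cancelʳ a (begin
            (σ ⟨$⟩ʳ inject₁ k) ⊕ a  ≡⟨ progression-step s 0<a a<p (inject₁→suc k) ⟨
            σ ⟨$⟩ʳ fs k             ≡⟨ σk≡sβ ⟩
            s ⊕ β                   ≡⟨ cong (_⊕ β) (progression-wraps s 0<a a<p) ⟨
            e ⊕ a ⊕ β               ≡⟨ ⊕-comm e a β ⟩
            e ⊕ β ⊕ a               ∎)
            where open ≡-Reasoning

      forward-chord : ∀ {x} → x ⊕ b ≢ t → PathEdge τ x (x ⊕ b)
      forward-chord = progression-edge t 0<b b<p

      backward-chord : ∀ {x} → x ≢ t → PathEdge τ x (x ⊕ n * b)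
      backward-chord {x} x≢t = PathEdge-sym τ (subst (PathEdge τ (x ⊕ n * b)) (⊕-inverseˡ x b)
        (forward-chord (λ eq → x≢t (trans (sym (⊕-inverseˡ x b)) eq))))

      x⊕-b≢x : ∀ x → x ⊕ n * b ≢ x
      x⊕-b≢x x eq = x⊕a≢x x 0<b b<p (sym (trans (sym (⊕-inverseˡ x b)) (cong (_⊕ b) eq)))

    -- β = b fails only if s or e is the last vertex of τ; then β = -b works.
    step-≢⇒HasHamCycle : HasHamCycle (PathEdge σ ∪ PathEdge τ)
    step-≢⇒HasHamCycle with s ⊕ b ≟ᶠ t | e ⊕ b ≟ᶠ t
    ... | no sb≢t | no eb≢t = rotate b (x⊕a≢x s 0<b b<p) (forward-chord sb≢t) (forward-chord eb≢t)
    ... | yes sb≡t | _ = rotate (n * b) (x⊕-b≢x s) (backward-chord s≢t) (backward-chord e≢t)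
      where
      s≢t : s ≢ t
      s≢t s≡t = x⊕a≢x s 0<b b<p (trans sb≡t (sym s≡t))
      e≢t : e ≢ t
      e≢t e≡t = x⊕a≢x e 0<a+b a+b<p (begin
        e ⊕ (a + b)  ≡⟨ ⊕-assoc e a b ⟨
        e ⊕ a ⊕ b    ≡⟨ cong (_⊕ b) (progression-wraps s 0<a a<p) ⟩
        s ⊕ b        ≡⟨ trans sb≡t (sym e≡t) ⟩
        e            ∎)
        where open ≡-Reasoning
    ... | no _ | yes eb≡t = rotate (n * b) (x⊕-b≢x s) (backward-chord s≢t) (backward-chord e≢t)
      where
      s≢t : s ≢ t
      s≢t s≡t = a≢b (⊕-cancelˡ-< e a<p b<p (trans (progression-wraps s 0<a a<p) (trans s≡t (sym eb≡t))))
      e≢t : e ≢ t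
      e≢t e≡t = x⊕a≢x e 0<b b<p (trans eb≡t (sym e≡t))

  module _ (H : ℕ) (2H<p : H + H < suc n) where

    private
      step : Fin H → ℕ
      step i = suc (toℕ i)

      steps<p : ∀ i j → step i + step j < suc n
      steps<p i j = ≤-<-trans (+-mono-≤ (toℕ<n i) (toℕ<n j)) 2H<p

      step<p : ∀ i → step i < suc n
      step<p i = ≤-<-trans (m≤m+n (step i) (step i)) (steps<p i i)

    arithmetic-paths : Fin H × Fin (suc n) → Permutation′ (suc n)
    arithmetic-paths (i , s) = progression s z<s (step<p i)

    arithmetic-paths-pairwise : PairwiseHamiltonian arithmetic-paths
    arithmetic-paths-pairwise {i , s} {j , t} is≢jt with i ≟ᶠ j
    ... | no i≢j =
      step-≢⇒¬SameEdges s t z<s (step<p i) z<s (step<p j) a≢b (steps<p i j) ,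
      step-≢⇒HasHamCycle s t z<s (step<p i) z<s (step<p j) a≢b (steps<p i j)
      where
      a≢b : step i ≢ step j
      a≢b a≡b = i≢j (toℕ-injective (suc-injective a≡b))
    ... | yes refl =
      start-≢⇒¬SameEdges z<s (step<p i) s t 1<n s≢t , start-≢⇒HasHamCycle z<s (step<p i) s t s≢t
      where
      s≢t : s ≢ t
      s≢t s≡t = is≢jt (cong (i ,_) s≡t)
      1<n : 1 < n
      1<n = ≤-trans (s≤s (≤-trans (s≤s z≤n) (m≤n+m (step i) (toℕ i)))) (s≤s⁻¹ (steps<p i i))

odd-prime : ∀ {p} → Prime p → 2 < p → ∃ λ H → p ≡ suc (H + H)
odd-prime {p} p-prime 2<p with p % 2 in p%2≡r | m%n<n p 2
... | 0 | _ = ⊥-elim ([ (λ ()) , <⇒≢ 2<p ]′ (prime⇒irreducible p-prime (m%n≡0⇒n∣m p 2 p%2≡r)))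
... | suc (suc _) | s≤s (s≤s ())
... | 1 | _ = p / 2 , (begin
  p                    ≡⟨ m≡m%n+[m/n]*n p 2 ⟩
  p % 2 + p / 2 * 2    ≡⟨ cong (_+ p / 2 * 2) p%2≡r ⟩
  suc (p / 2 * 2)      ≡⟨ cong suc (*2≡+ (p / 2)) ⟩
  suc (p / 2 + p / 2)  ∎)
  where
  open ≡-Reasoning
  *2≡+ : ∀ m → m * 2 ≡ m + m
  *2≡+ = solve-∀

[1+2H]C2≡H*[1+2H] : ∀ H → suc (H + H) C 2 ≡ H * suc (H + H)
[1+2H]C2≡H*[1+2H] zero = refl
[1+2H]C2≡H*[1+2H] H@(suc h) = begin
  p C 2          ≡⟨ nCk≡nPk/k! {2} {p} (s≤s (s≤s z≤n)) ⟩
  (p P 2) / 2    ≡⟨ cong (_/ 2) (falling h) ⟩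
  H * p * 2 / 2  ≡⟨ m*n/n≡m (H * p) 2 ⟩
  H * p          ∎
  where
  open ≡-Reasoning
  p = suc (H + H)
  falling : ∀ h → suc (h + suc h) * (suc (suc h + suc h) * 1) ≡ suc h * suc (suc h + suc h) * 2
  falling = solve-∀

claim3p3 : (p : ℕ) → Prime p → p > 2 →
    Σ (Fin (p C 2) → Graph p) λ P →
      ((k : Fin (p C 2)) → IsHamPath (P k)) ×
      ((k l : Fin (p C 2)) → k ≢ l → ¬ SameEdges (P k) (P l)) ×
      ((k l : Fin (p C 2)) → k ≢ l → HasHamCycle (P k ∪ P l))
claim3p3 p p-prime 2<p with odd-prime p-prime 2<p
... | H , refl rewrite [1+2H]C2≡H*[1+2H] H =
  (λ k → PathEdge (paths k)) ,
  (λ k → paths k , λ _ _ → mk⇔ id id) ,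
  (λ k l k≢l → proj₁ (pairwise k≢l)) ,
  (λ k l k≢l → proj₂ (pairwise k≢l))
  where
  open Progressions (H + H) p-prime
  2H<p : H + H < p
  2H<p = n<1+n (H + H)
  paths : Fin (H * p) → Permutation′ p
  paths = arithmetic-paths H 2H<p ∘ remQuot p
  pairwise : PairwiseHamiltonian paths
  pairwise = PairwiseHamiltonian-∘ {σ = arithmetic-paths H 2H<p} (remQuot p) (remQuot-injective p)
               (arithmetic-paths-pairwise H 2H<p)
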